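{- Let $A$ be a circular $m\times n$ matrix without dominating rows, and $\Gamma$ a circuit in $F(A)$ with winding number $p$. For $j\in[n]$ let $r(j)$ be the number of row arcs of $\Gamma$ that jump over $j$. Then $r(j)=p-1$ if $j\in\circ(\Gamma)$, $r(j)=p+1$ if $j\in\otimes(\Gamma)$, and $r(j)=p$ if $j$ is a bullet of $\Gamma$.
   Context: $[n]=\{1,\dots,n\}$ with addition mod $n$ (node $0$ identified with $n$); for $a,c\in[n]$, $(a,c]_n$ is the cyclic interval $\{a+1,\dots,c\}$ mod $n$ and $[a,c)_n=\{a,\dots,c-1\}$. A $\{0,1\}$ $m\times n$ matrix $A$ is circular if each row $i$ is the incidence vector of $[\ell_i,\ell_i+k_i)_n$, $2\le k_i\le n-1$; row $i$ dominates row $\ell\ne i$ if $a_{ij}\ge a_{\ell j}$ for all $j$. $F(A)$: digraph on $[n]$ with row arcs $(\ell_i-1,\ell_i+k_i-1)$ (length $k_i$), forward short arcs $(j-1,j)$ (length 1), reverse short arcs $(j,j-1)$ (length $-1$). Circuit = simple directed circuit; winding number $p$: $pn=$ sum of arc lengths. A row arc $(u,v)$ jumps over $j$ iff $j\in(u,v]_n$. Circles $\circ(\Gamma)=\{j:(j-1,j)\in E(\Gamma)\}$, crosses $\otimes(\Gamma)=\{j:(j,j-1)\in E(\Gamma)\}$, bullets $=[n]\setminus(\circ(\Gamma)\cup\otimes(\Gamma))$. -}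

module Defs where

open import Data.Bool using (Bool; true; false; _∧_)
open import Data.Nat using (ℕ; zero; suc; _+_; _∸_; _≤_; _<_; _≤ᵇ_; _<ᵇ_; NonZero; _%_)
open import Data.Nat.DivMod using (_mod_)
open import Data.Fin using (Fin; toℕ)
open import Data.Integer as ℤ using (ℤ; +_; -[1+_])
open import Data.List using (List; []; _∷_; _++_; take; map; length; filterᵇ)
open import Data.List.Relation.Unary.Unique.Propositional using (Unique)
open import Data.Product using (_×_)
open import Data.Unit using (⊤)
open import Relation.Binary.PropositionalEquality using (_≡_; _≢_)

-- Nodes of [n] = {1,…,n} are represented by residues mod n, i.e. Fin n
-- (node n ≡ node 0 is represented by 0).

module _ (n : ℕ) .{{_ : NonZero n}} where

  nd : ℕ → Fin n
  nd x = x mod n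

  dist : Fin n → Fin n → ℕ
  dist a b = ((toℕ b + n) ∸ toℕ a) % n

  inOC : Fin n → Fin n → Fin n → Bool
  inOC a c j = (1 ≤ᵇ dist a j) ∧ (dist a j ≤ᵇ dist a c)

  inCO : Fin n → Fin n → Fin n → Bool
  inCO a c j = dist a j <ᵇ dist a c

-- Circular m×n matrices, given by their row data ℓ_i ∈ [n], 2 ≤ k_i ≤ n-1.

record Circular (m n : ℕ) .{{_ : NonZero n}} : Set where
  field
    ℓ  : Fin m → Fin n
    k  : Fin m → ℕ
    k≥2   : ∀ i → 2 ≤ k i
    k≤n-1 : ∀ i → k i ≤ n ∸ 1

  entry : Fin m → Fin n → Bool
  entry i j = inCO n (ℓ i) (nd n (toℕ (ℓ i) + k i)) j

  Dominates : Fin m → Fin m → Set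
  Dominates i i' = (i ≢ i') × (∀ j → entry i' j ≡ true → entry i j ≡ true)

  NoDominatingRows : Set
  NoDominatingRows = ∀ i i' → Dominates i i' → Data.Empty.⊥
    where import Data.Empty

  -- The digraph F(A) (a multidigraph; arcs are labelled).

  data Arc : Set where
    row : Fin m → Arc
    fwd : Fin n → Arc
    rev : Fin n → Arc

  tail : Arc → Fin n
  tail (row i) = nd n (toℕ (ℓ i) + n ∸ 1)
  tail (fwd j) = nd n (toℕ j + n ∸ 1)
  tail (rev j) = j

  head : Arc → Fin n
  head (row i) = nd n (toℕ (ℓ i) + k i + n ∸ 1)
  head (fwd j) = j
  head (rev j) = nd n (toℕ j + n ∸ 1)

  len : Arc → ℤ
  len (row i) = + k i
  len (fwd j) = + 1
  len (rev j) = -[1+ 0 ]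

  isRow : Arc → Bool
  isRow (row _) = true
  isRow (fwd _) = false
  isRow (rev _) = false

  Chain : List Arc → Set
  Chain []           = ⊤
  Chain (e ∷ [])     = ⊤
  Chain (e ∷ f ∷ es) = (head e ≡ tail f) × Chain (f ∷ es)

  NonEmpty : List Arc → Set
  NonEmpty []      = Data.Empty.⊥
    where import Data.Empty
  NonEmpty (_ ∷ _) = ⊤

  IsCircuit : List Arc → Set
  IsCircuit Γ = NonEmpty Γ × Chain (Γ ++ take 1 Γ) × Unique (map tail Γ)

  totalLength : List Arc → ℤ
  totalLength []       = + 0
  totalLength (e ∷ es) = len e ℤ.+ totalLength es

  Winding : List Arc → ℤ → Set
  Winding Γ p = p ℤ.* (+ n) ≡ totalLength Γ

  jumpsOver : Arc → Fin n → Bool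
  jumpsOver e j = inOC n (tail e) (head e) j

  r : List Arc → Fin n → ℕ
  r Γ j = length (filterᵇ (λ e → isRow e ∧ jumpsOver e j) Γ)

-- Fix j and place every node x at φ(x) = dist j x ∈ [0, n), its forward distance from j.
-- Each arc e from t to h then satisfies
--   len e = φ(h) − φ(t) + n · c(e),
-- where c(e) is the signed number of times e passes over j: [e jumps over j] for a row arc,
-- [x = j] for the forward arc (x−1, x) and −[x = j] for the reverse arc (x, x−1).  Summed around
-- a circuit the φ-terms telescope, so p = Σ c(e) = r(j) + #{fwd j ∈ Γ} − #{rev j ∈ Γ}, and each of
-- the two counts is at most 1 because a circuit leaves every node only once.

module Submission where

open import Data.Bool using (Bool; true; false; T; _∧_)
open import Data.Empty using (⊥-elim)
open import Data.Fin using (Fin; toℕ; _≟_)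
open import Data.List.Membership.Propositional using (_∈_; _∉_)
open import Data.List.Properties using (filter-none; filter-accept; filter-reject)
open import Data.List.Relation.Unary.All as All using ()
open import Data.List.Relation.Unary.Any using (here; there)
open import Data.List.Relation.Unary.AllPairs using (_∷_)
open import Data.List.Relation.Unary.Unique.Propositional using (Unique)
open import Data.List.Relation.Unary.Unique.Propositional.Properties
  using (Unique[x∷xs]⇒x∉xs) renaming (map⁻ to Unique-map⁻)
open import Data.List using (List; []; _∷_; _++_; length; filterᵇ)
open import Data.Nat as ℕ using (ℕ; NonZero)
open import Data.Nat.Properties using (≤-<-trans)
open import Data.Product using (_×_; _,_; ∃; proj₂)
open import Function using (_∘_)
open import Relation.Nullary using (¬_; does; yes; no)
open import Relation.Nullary.Decidable using (T?; dec-true)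
open import Relation.Binary.PropositionalEquality

open import Defs

𝟙 : Bool → ℕ
𝟙 true  = 1
𝟙 false = 0

module Arithmetic where
  open import Data.Fin.Properties using (toℕ-fromℕ<; toℕ<n; toℕ-injective; fromℕ<-cong)
  open import Data.Nat using (suc; _+_; _*_; _∸_; _≤_; _<_; _≤ᵇ_; _≤?_; _%_; >-nonZero⁻¹)
  open import Data.Nat.DivMod
    using (m%n<n; m<n⇒m%n≡m; n%n≡0; [m+n]%n≡m%n; %-distribˡ-+; m%n%n≡m%n; m≤n⇒[n∸m]%m≡n%m)
  open import Data.Nat.Properties hiding (_≟_)
  open import Relation.Binary.Definitions using (tri<; tri≈; tri>)
  open import Algebra.Properties.CommutativeSemigroup +-commutativeSemigroup using (xy∙z≈xz∙y)

  ≤ᵇ-true : ∀ {m n} → m ≤ n → (m ≤ᵇ n) ≡ true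
  ≤ᵇ-true {m} {n} m≤n with m ≤ᵇ n | ≤⇒≤ᵇ m≤n
  ... | true  | _  = refl
  ... | false | ()

  ≤ᵇ-false : ∀ {m n} → n < m → (m ≤ᵇ n) ≡ false
  ≤ᵇ-false {m} {n} n<m with m ≤ᵇ n | ≤ᵇ⇒≤ m n
  ... | true  | m≤n = ⊥-elim (<⇒≱ n<m (m≤n _))
  ... | false | _   = refl

  ≤ᵇ-cong : ∀ {m n m′ n′} → (m ≤ n → m′ ≤ n′) → (m′ ≤ n′ → m ≤ n) → (m ≤ᵇ n) ≡ (m′ ≤ᵇ n′)
  ≤ᵇ-cong {m} {n} to from with m ≤? n
  ... | yes m≤n = trans (≤ᵇ-true m≤n) (sym (≤ᵇ-true (to m≤n)))
  ... | no  m≰n = trans (≤ᵇ-false (≰⇒> m≰n)) (sym (≤ᵇ-false (≰⇒> (m≰n ∘ from))))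

  [m%n+k]%n≡[m+k]%n : ∀ m k n .{{_ : NonZero n}} → (m % n + k) % n ≡ (m + k) % n
  [m%n+k]%n≡[m+k]%n m k n = begin
    (m % n + k) % n         ≡⟨ %-distribˡ-+ (m % n) k n ⟩
    (m % n % n + k % n) % n ≡⟨ cong (λ x → (x + k % n) % n) (m%n%n≡m%n m n) ⟩
    (m % n + k % n) % n     ≡⟨ %-distribˡ-+ m k n ⟨
    (m + k) % n             ∎
    where open ≡-Reasoning

  %-wrap : ∀ {n x} .{{_ : NonZero n}} → x < n + n → x ≡ x % n + n * 𝟙 (n ≤ᵇ x)
  %-wrap {n} {x} x<2n with n ≤? x
  ... | yes n≤x = begin
    x                 ≡⟨ m∸n+n≡m n≤x ⟨
    x ∸ n + n         ≡⟨ cong₂ _+_ x∸n≡x%n (*-identityʳ n) ⟨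
    x % n + n * 1     ≡⟨ cong (λ b → x % n + n * 𝟙 b) (≤ᵇ-true n≤x) ⟨
    x % n + n * 𝟙 (n ≤ᵇ x) ∎
    where
    open ≡-Reasoning
    x∸n≡x%n : x % n ≡ x ∸ n
    x∸n≡x%n = trans (sym (m≤n⇒[n∸m]%m≡n%m n≤x)) (m<n⇒m%n≡m (m<n+o⇒m∸n<o x n x<2n))
  ... | no n≰x = begin
    x                 ≡⟨ m<n⇒m%n≡m (≰⇒> n≰x) ⟨
    x % n             ≡⟨ +-identityʳ (x % n) ⟨
    x % n + 0         ≡⟨ cong (λ y → x % n + y) (*-zeroʳ n) ⟨
    x % n + n * 0     ≡⟨ cong (λ b → x % n + n * 𝟙 b) (≤ᵇ-false (≰⇒> n≰x)) ⟨
    x % n + n * 𝟙 (n ≤ᵇ x) ∎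
    where open ≡-Reasoning

  +-cancelʳ-≤ᵇ : ∀ m n o → (m + o ≤ᵇ n + o) ≡ (m ≤ᵇ n)
  +-cancelʳ-≤ᵇ m n o = ≤ᵇ-cong (+-cancelʳ-≤ o m n) (+-monoˡ-≤ o)

  [n∸m]+[m+o∸n]≡o : ∀ {m n o} → m ≤ n → n ≤ m + o → (n ∸ m) + (m + o ∸ n) ≡ o
  [n∸m]+[m+o∸n]≡o {m} {n} {o} m≤n n≤m+o = begin
    (n ∸ m) + (m + o ∸ n)             ≡⟨ cong (λ x → (n ∸ m) + (m + o ∸ x)) (m+[n∸m]≡n m≤n) ⟨
    (n ∸ m) + (m + o ∸ (m + (n ∸ m))) ≡⟨ cong (λ x → (n ∸ m) + x) ([m+n]∸[m+o]≡n∸o m o (n ∸ m)) ⟩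
    (n ∸ m) + (o ∸ (n ∸ m))           ≡⟨ m+[n∸m]≡n (m≤n+o⇒m∸n≤o n m n≤m+o) ⟩
    o                                 ∎
    where open ≡-Reasoning

  module Cyclic (n : ℕ) .{{_ : NonZero n}} where

    prev : Fin n → Fin n
    prev x = nd n (toℕ x + n ∸ 1)

    1≤n : 1 ≤ n
    1≤n = >-nonZero⁻¹ n

    n∸1<n : n ∸ 1 < n
    n∸1<n = m<n+o⇒m∸n<o n 1 (n<1+n n)

    toℕ-nd : ∀ x → toℕ (nd n x) ≡ x % n
    toℕ-nd x = toℕ-fromℕ< (m%n<n x n)

    nd-cong : ∀ {x y} → x % n ≡ y % n → nd n x ≡ nd n y
    nd-cong {x} {y} eq = fromℕ<-cong (x % n) (y % n) eq (m%n<n x n) (m%n<n y n)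

    nd-toℕ : ∀ a → nd n (toℕ a) ≡ a
    nd-toℕ a = toℕ-injective (trans (toℕ-nd (toℕ a)) (m<n⇒m%n≡m (toℕ<n a)))

    nd-+ : ∀ x k → nd n (toℕ (nd n x) + k) ≡ nd n (x + k)
    nd-+ x k = nd-cong (trans (cong (λ y → (y + k) % n) (toℕ-nd x)) ([m%n+k]%n≡[m+k]%n x k n))

    dist<n : ∀ a b → dist n a b < n
    dist<n a b = m%n<n _ n

    dist-≤ : ∀ {a b} → toℕ a ≤ toℕ b → dist n a b ≡ toℕ b ∸ toℕ a
    dist-≤ {a} {b} a≤b = begin
      (toℕ b + n ∸ toℕ a) % n ≡⟨ cong (_% n) (+-∸-comm n a≤b) ⟩
      (toℕ b ∸ toℕ a + n) % n ≡⟨ [m+n]%n≡m%n (toℕ b ∸ toℕ a) n ⟩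
      (toℕ b ∸ toℕ a) % n     ≡⟨ m<n⇒m%n≡m (≤-<-trans (m∸n≤m (toℕ b) (toℕ a)) (toℕ<n b)) ⟩
      toℕ b ∸ toℕ a           ∎
      where open ≡-Reasoning

    dist-> : ∀ {a b} → toℕ b < toℕ a → dist n a b ≡ toℕ b + n ∸ toℕ a
    dist-> {a} {b} b<a = m<n⇒m%n≡m (m<n+o⇒m∸n<o (toℕ b + n) (toℕ a) (+-monoˡ-< n b<a))

    dist-self : ∀ a → dist n a a ≡ 0
    dist-self a = trans (dist-≤ {a} {a} ≤-refl) (n∸n≡0 (toℕ a))

    dist-+-dist-< : ∀ {a b} → toℕ a < toℕ b → dist n a b + dist n b a ≡ n
    dist-+-dist-< {a} {b} a<b = begin
      dist n a b + dist n b a             ≡⟨ cong₂ _+_ (dist-≤ (<⇒≤ a<b)) (dist-> a<b) ⟩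
      (toℕ b ∸ toℕ a) + (toℕ a + n ∸ toℕ b) ≡⟨ [n∸m]+[m+o∸n]≡o (<⇒≤ a<b) (≤-trans (<⇒≤ (toℕ<n b)) (m≤n+m n (toℕ a))) ⟩
      n                                   ∎
      where open ≡-Reasoning

    dist-+-dist : ∀ {a b} → a ≢ b → dist n a b + dist n b a ≡ n
    dist-+-dist {a} {b} a≢b with <-cmp (toℕ a) (toℕ b)
    ... | tri< a<b _ _ = dist-+-dist-< a<b
    ... | tri≈ _ a≡b _ = ⊥-elim (a≢b (toℕ-injective a≡b))
    ... | tri> _ _ b<a = trans (+-comm (dist n a b) (dist n b a)) (dist-+-dist-< b<a)

    dist≡0⇒≡ : ∀ {a b} → dist n a b ≡ 0 → a ≡ b
    dist≡0⇒≡ {a} {b} d≡0 with a ≟ b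
    ... | yes a≡b = a≡b
    ... | no  a≢b = ⊥-elim (<-irrefl (trans (cong (_+ dist n b a) (sym d≡0)) (dist-+-dist a≢b)) (dist<n b a))

    dist-nd-+ : ∀ u t k → dist n u (nd n (toℕ t + k)) ≡ (dist n u t + k) % n
    dist-nd-+ u t k = begin
      (toℕ (nd n (t′ + k)) + n ∸ u′) % n ≡⟨ cong (λ y → (y + n ∸ u′) % n) (toℕ-nd (t′ + k)) ⟩
      ((t′ + k) % n + n ∸ u′) % n        ≡⟨ cong (_% n) (+-∸-assoc ((t′ + k) % n) u≤n) ⟩
      ((t′ + k) % n + (n ∸ u′)) % n      ≡⟨ [m%n+k]%n≡[m+k]%n (t′ + k) (n ∸ u′) n ⟩
      (t′ + k + (n ∸ u′)) % n            ≡⟨ cong (_% n) (xy∙z≈xz∙y t′ k (n ∸ u′)) ⟩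
      (t′ + (n ∸ u′) + k) % n            ≡⟨ [m%n+k]%n≡[m+k]%n (t′ + (n ∸ u′)) k n ⟨
      ((t′ + (n ∸ u′)) % n + k) % n      ≡⟨ cong (λ y → (y % n + k) % n) (+-∸-assoc t′ u≤n) ⟨
      ((t′ + n ∸ u′) % n + k) % n        ∎
      where
      open ≡-Reasoning
      t′ = toℕ t
      u′ = toℕ u
      u≤n : u′ ≤ n
      u≤n = <⇒≤ (toℕ<n u)

    dist-nd : ∀ t k → k < n → dist n t (nd n (toℕ t + k)) ≡ k
    dist-nd t k k<n = begin
      dist n t (nd n (toℕ t + k)) ≡⟨ dist-nd-+ t t k ⟩
      (dist n t t + k) % n        ≡⟨ cong (λ d → (d + k) % n) (dist-self t) ⟩
      k % n                       ≡⟨ m<n⇒m%n≡m k<n ⟩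
      k                           ∎
      where open ≡-Reasoning

    prev≡nd : ∀ a → prev a ≡ nd n (toℕ a + (n ∸ 1))
    prev≡nd a = cong (nd n) (+-∸-assoc (toℕ a) 1≤n)

    dist-prev : ∀ a → dist n a (prev a) ≡ n ∸ 1
    dist-prev a = trans (cong (dist n a) (prev≡nd a)) (dist-nd a (n ∸ 1) n∸1<n)

    nd-prev-+1 : ∀ a → nd n (toℕ (prev a) + 1) ≡ a
    nd-prev-+1 a = begin
      nd n (toℕ (prev a) + 1) ≡⟨ nd-+ (toℕ a + n ∸ 1) 1 ⟩
      nd n (toℕ a + n ∸ 1 + 1) ≡⟨ cong (nd n) (m∸n+n≡m (≤-trans 1≤n (m≤n+m n (toℕ a)))) ⟩
      nd n (toℕ a + n)         ≡⟨ nd-cong ([m+n]%n≡m%n (toℕ a) n) ⟩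
      nd n (toℕ a)             ≡⟨ nd-toℕ a ⟩
      a                        ∎
      where open ≡-Reasoning

    nd-∸1-+ : ∀ a k → nd n (toℕ (nd n (a + n ∸ 1)) + k) ≡ nd n (a + k + n ∸ 1)
    nd-∸1-+ a k = trans (nd-+ (a + n ∸ 1) k) (cong (nd n) (begin
      a + n ∸ 1 + k ≡⟨ +-∸-comm k (≤-trans 1≤n (m≤n+m n a)) ⟨
      a + n + k ∸ 1 ≡⟨ cong (_∸ 1) (xy∙z≈xz∙y a k n) ⟨
      a + k + n ∸ 1 ∎))
      where open ≡-Reasoning

    overflow≡inOC : ∀ u t k → k < n → (n ≤ᵇ dist n u t + k) ≡ inOC n t (nd n (toℕ t + k)) u
    overflow≡inOC u t k k<n with t ≟ u
    ... | yes refl = begin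
      n ≤ᵇ dist n t t + k ≡⟨ cong (λ d → n ≤ᵇ d + k) (dist-self t) ⟩
      n ≤ᵇ k              ≡⟨ ≤ᵇ-false k<n ⟩
      false               ≡⟨ cong (λ d → (1 ≤ᵇ d) ∧ (d ≤ᵇ dist n t (nd n (toℕ t + k)))) (dist-self t) ⟨
      inOC n t (nd n (toℕ t + k)) t ∎
      where open ≡-Reasoning
    ... | no t≢u = begin
      n ≤ᵇ dist n u t + k                       ≡⟨ cong₂ _≤ᵇ_ (sym (dist-+-dist t≢u)) (+-comm (dist n u t) k) ⟩
      dist n t u + dist n u t ≤ᵇ k + dist n u t ≡⟨ +-cancelʳ-≤ᵇ (dist n t u) k (dist n u t) ⟩
      dist n t u ≤ᵇ k                           ≡⟨ cong₂ (λ b c → b ∧ (dist n t u ≤ᵇ c)) (≤ᵇ-true 1≤dist) (dist-nd t k k<n) ⟨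
      inOC n t (nd n (toℕ t + k)) u             ∎
      where
      open ≡-Reasoning
      1≤dist : 1 ≤ dist n t u
      1≤dist = n≢0⇒n>0 (t≢u ∘ dist≡0⇒≡)

    dist-+-overflow : ∀ u t k → k < n →
      dist n u t + k ≡ dist n u (nd n (toℕ t + k)) + n * 𝟙 (inOC n t (nd n (toℕ t + k)) u)
    dist-+-overflow u t k k<n = begin
      dist n u t + k                                       ≡⟨ %-wrap (+-mono-< (dist<n u t) k<n) ⟩
      (dist n u t + k) % n + n * 𝟙 (n ≤ᵇ dist n u t + k)   ≡⟨ cong₂ (λ d b → d + n * 𝟙 b) (sym (dist-nd-+ u t k)) (overflow≡inOC u t k k<n) ⟩
      dist n u (nd n (toℕ t + k)) + n * 𝟙 (inOC n t (nd n (toℕ t + k)) u) ∎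
      where open ≡-Reasoning

    dist-prev-+1 : ∀ u x → dist n u (prev x) + 1 ≡ dist n u x + n * 𝟙 (does (x ≟ u))
    dist-prev-+1 u x with x ≟ u
    ... | yes refl = begin
      dist n x (prev x) + 1 ≡⟨ cong (_+ 1) (dist-prev x) ⟩
      n ∸ 1 + 1             ≡⟨ m∸n+n≡m 1≤n ⟩
      n                     ≡⟨ *-identityʳ n ⟨
      n * 1                 ≡⟨ cong (_+ n * 1) (dist-self x) ⟨
      dist n x x + n * 1    ∎
      where open ≡-Reasoning
    ... | no x≢u = begin
      dist n u (prev x) + 1         ≡⟨ m<n⇒m%n≡m no-overflow ⟨
      (dist n u (prev x) + 1) % n   ≡⟨ dist-succ ⟨
      dist n u x                    ≡⟨ +-identityʳ (dist n u x) ⟨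
      dist n u x + 0                ≡⟨ cong (λ y → dist n u x + y) (*-zeroʳ n) ⟨
      dist n u x + n * 0            ∎
      where
      open ≡-Reasoning
      dist-succ : dist n u x ≡ (dist n u (prev x) + 1) % n
      dist-succ = trans (cong (dist n u) (sym (nd-prev-+1 x))) (dist-nd-+ u (prev x) 1)
      no-overflow : dist n u (prev x) + 1 < n
      no-overflow = ≤∧≢⇒< (subst (_≤ n) (+-comm 1 _) (dist<n u (prev x)))
        (λ eq → x≢u (sym (dist≡0⇒≡ (trans dist-succ (trans (cong (_% n) eq) (n%n≡0 n))))))

open Arithmetic

countᵇ : {X : Set} → (X → Bool) → List X → ℕ
countᵇ P xs = length (filterᵇ P xs)

module _ {X : Set} {P : X → Bool} where

  countᵇ-∷ : ∀ x xs → countᵇ P (x ∷ xs) ≡ 𝟙 (P x) ℕ.+ countᵇ P xs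
  countᵇ-∷ x xs with P x
  ... | true  = refl
  ... | false = refl

  countᵇ-absent : ∀ {x xs} → (∀ {y} → T (P y) → y ≡ x) → x ∉ xs → countᵇ P xs ≡ 0
  countᵇ-absent only x∉xs = cong length
    (filter-none (T? ∘ P) (All.tabulate (λ y∈xs Py → x∉xs (subst (_∈ _) (only Py) y∈xs))))

  countᵇ-unique : ∀ {x xs} → (∀ {y} → T (P y) → y ≡ x) → T (P x) → Unique xs → x ∈ xs → countᵇ P xs ≡ 1
  countᵇ-unique only Px u (here refl) =
    trans (cong length (filter-accept (T? ∘ P) Px)) (cong ℕ.suc (countᵇ-absent only (Unique[x∷xs]⇒x∉xs u)))
  countᵇ-unique only Px (y≢ys ∷ u) (there x∈ys) =
    trans (cong length (filter-reject (T? ∘ P) (λ Py → All.lookup y≢ys x∈ys (only Py)))) (countᵇ-unique only Px u x∈ys)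

open import Data.Integer using (ℤ; +_; -_; _+_; _-_; _*_)
open import Data.Integer.Properties using (pos-*; +-identityʳ; *-cancelʳ-≡)
open import Data.Integer.Tactic.RingSolver using (solve-∀)

pos-balance : ∀ {a b k c N} → a ℕ.+ k ≡ b ℕ.+ N ℕ.* c → + k ≡ + b - + a + + N * + c
pos-balance {a} {b} {k} {c} {N} eq = begin
  + k                     ≡⟨ k≡a+k-a (+ a) (+ k) ⟩
  + a + + k - + a         ≡⟨ cong (λ y → + y - + a) eq ⟩
  + (b ℕ.+ N ℕ.* c) - + a ≡⟨ cong (λ y → + b + y - + a) (pos-* N c) ⟩
  + b + + N * + c - + a   ≡⟨ rearrange (+ a) (+ b) (+ N * + c) ⟩
  + b - + a + + N * + c   ∎
  where
  open ≡-Reasoning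
  k≡a+k-a : ∀ a k → k ≡ a + k - a
  k≡a+k-a = solve-∀
  rearrange : ∀ a b x → b + x - a ≡ b - a + x
  rearrange = solve-∀

module Crossings {m n : ℕ} .{{_ : NonZero n}} (A : Circular m n) (j : Fin n) where
  open Circular A
  open Cyclic n

  isFwdAt isRevAt : Arc → Bool
  isFwdAt (fwd x) = does (x ≟ j)
  isFwdAt _       = false
  isRevAt (rev x) = does (x ≟ j)
  isRevAt _       = false

  crossing : Arc → ℤ
  crossing (row i) = + 𝟙 (jumpsOver (row i) j)
  crossing (fwd x) = + 𝟙 (does (x ≟ j))
  crossing (rev x) = - + 𝟙 (does (x ≟ j))

  crossings : List Arc → ℤ
  crossings Γ = + r Γ j + + countᵇ isFwdAt Γ - + countᵇ isRevAt Γ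

  crossings-∷ : ∀ e es → crossings (e ∷ es) ≡ crossing e + crossings es
  crossings-∷ (row i) es = trans
    (cong (λ y → + y + + countᵇ isFwdAt es - + countᵇ isRevAt es) (countᵇ-∷ {P = λ e → isRow e ∧ jumpsOver e j} (row i) es))
    (row-step (+ 𝟙 (jumpsOver (row i) j)) (+ r es j) (+ countᵇ isFwdAt es) (+ countᵇ isRevAt es))
    where
    row-step : ∀ c R F V → (c + R) + F - V ≡ c + (R + F - V)
    row-step = solve-∀
  crossings-∷ (fwd x) es = trans
    (cong (λ y → + r es j + + y - + countᵇ isRevAt es) (countᵇ-∷ {P = isFwdAt} (fwd x) es))
    (fwd-step (+ 𝟙 (does (x ≟ j))) (+ r es j) (+ countᵇ isFwdAt es) (+ countᵇ isRevAt es))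
    where
    fwd-step : ∀ c R F V → R + (c + F) - V ≡ c + (R + F - V)
    fwd-step = solve-∀
  crossings-∷ (rev x) es = trans
    (cong (λ y → + r es j + + countᵇ isFwdAt es - + y) (countᵇ-∷ {P = isRevAt} (rev x) es))
    (rev-step (+ 𝟙 (does (x ≟ j))) (+ r es j) (+ countᵇ isFwdAt es) (+ countᵇ isRevAt es))
    where
    rev-step : ∀ c R F V → R + F - (c + V) ≡ - c + (R + F - V)
    rev-step = solve-∀

  potential : Fin n → ℤ
  potential x = + dist n j x

  arc-balance : ∀ e → len e ≡ potential (head e) - potential (tail e) + + n * crossing e
  arc-balance (row i) = subst (λ h → + k i ≡ potential h - potential t + + n * + 𝟙 (inOC n t h j))
    (nd-∸1-+ (toℕ (ℓ i)) (k i)) (pos-balance {N = n} (dist-+-overflow j t (k i) (≤-<-trans (k≤n-1 i) n∸1<n)))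
    where t = tail (row i)
  arc-balance (fwd x) = pos-balance {N = n} (dist-prev-+1 j x)
  arc-balance (rev x) =
    trans (cong -_ (arc-balance (fwd x))) (reverse (potential (prev x)) (potential x) (+ n) (+ 𝟙 (does (x ≟ j))))
    where
    reverse : ∀ a b N c → - (b - a + N * c) ≡ a - b + N * - c
    reverse = solve-∀

  arc-balance-into : ∀ e {y} → head e ≡ y → len e ≡ potential y - potential (tail e) + + n * crossing e
  arc-balance-into e refl = arc-balance e

  walk-balance : ∀ e es x → Chain (e ∷ es ++ x ∷ []) →
    totalLength (e ∷ es) ≡ potential (tail x) - potential (tail e) + + n * crossings (e ∷ es)
  walk-balance e [] x (e→x , _) = begin
    len e + + 0                                                   ≡⟨ +-identityʳ (len e) ⟩
    len e                                                         ≡⟨ arc-balance-into e e→x ⟩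
    potential (tail x) - potential (tail e) + + n * crossing e     ≡⟨ cong (λ c → potential (tail x) - potential (tail e) + + n * c) crossing≡ ⟩
    potential (tail x) - potential (tail e) + + n * crossings (e ∷ []) ∎
    where
    open ≡-Reasoning
    crossing≡ : crossing e ≡ crossings (e ∷ [])
    crossing≡ = sym (trans (crossings-∷ e []) (+-identityʳ (crossing e)))
  walk-balance e (f ∷ fs) x (e→f , chain) = begin
    len e + totalLength (f ∷ fs)
      ≡⟨ cong₂ _+_ (arc-balance-into e e→f) (walk-balance f fs x chain) ⟩
    (potential (tail f) - potential (tail e) + + n * crossing e) + (potential (tail x) - potential (tail f) + + n * crossings (f ∷ fs))
      ≡⟨ telescope (potential (tail e)) (potential (tail f)) (potential (tail x)) (+ n) (crossing e) (crossings (f ∷ fs)) ⟩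
    potential (tail x) - potential (tail e) + + n * (crossing e + crossings (f ∷ fs))
      ≡⟨ cong (λ c → potential (tail x) - potential (tail e) + + n * c) (crossings-∷ e (f ∷ fs)) ⟨
    potential (tail x) - potential (tail e) + + n * crossings (e ∷ f ∷ fs)
      ∎
    where
    open ≡-Reasoning
    telescope : ∀ a b c N C D → (b - a + N * C) + (c - b + N * D) ≡ c - a + N * (C + D)
    telescope = solve-∀

  winding≡crossings : ∀ {Γ} p → IsCircuit Γ → Winding Γ p → p ≡ crossings Γ
  winding≡crossings {[]} _ (() , _)
  winding≡crossings {e ∷ es} p (_ , closed , _) wind = *-cancelʳ-≡ p (crossings (e ∷ es)) (+ n) (begin
    p * + n                                                            ≡⟨ wind ⟩
    totalLength (e ∷ es)                                               ≡⟨ walk-balance e es e closed ⟩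
    potential (tail e) - potential (tail e) + + n * crossings (e ∷ es) ≡⟨ cancel (potential (tail e)) (+ n) (crossings (e ∷ es)) ⟩
    crossings (e ∷ es) * + n                                           ∎)
    where
    open ≡-Reasoning
    cancel : ∀ a N c → a - a + N * c ≡ c * N
    cancel = solve-∀

  r≡p-fwd+rev : ∀ {Γ} p → IsCircuit Γ → Winding Γ p →
    + r Γ j ≡ p - + countᵇ isFwdAt Γ + + countᵇ isRevAt Γ
  r≡p-fwd+rev {Γ} p circuit wind = trans
    (isolate (+ r Γ j) (+ countᵇ isFwdAt Γ) (+ countᵇ isRevAt Γ))
    (cong (λ q → q - + countᵇ isFwdAt Γ + + countᵇ isRevAt Γ) (sym (winding≡crossings p circuit wind)))
    where
    isolate : ∀ R F V → R ≡ R + F - V - F + V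
    isolate = solve-∀

  isFwdAt⇒fwd : ∀ {e} → T (isFwdAt e) → e ≡ fwd j
  isFwdAt⇒fwd {fwd x} x≡j with x ≟ j
  ... | yes refl = refl

  isRevAt⇒rev : ∀ {e} → T (isRevAt e) → e ≡ rev j
  isRevAt⇒rev {rev x} x≡j with x ≟ j
  ... | yes refl = refl

  j≟j : T (does (j ≟ j))
  j≟j rewrite dec-true (j ≟ j) refl = _

lemma6p1 : ∀ {m n : ℕ} .{{_ : NonZero n}} (A : Circular m n)
    → Circular.NoDominatingRows A
    → (Γ : List (Circular.Arc A)) → Circular.IsCircuit A Γ
    → ¬ (∃ λ j → (Circular.fwd j ∈ Γ) × (Circular.rev j ∈ Γ))
    → (p : ℤ) → Circular.Winding A Γ p
    → (j : Fin n)
    → (Circular.fwd j ∈ Γ → + Circular.r A Γ j ≡ p - + 1)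
      × (Circular.rev j ∈ Γ → + Circular.r A Γ j ≡ p + + 1)
      × (Circular.fwd j ∉ Γ → Circular.rev j ∉ Γ → + Circular.r A Γ j ≡ p)
lemma6p1 A _ Γ circuit no-fwd-and-rev p wind j = on-circle , on-cross , on-bullet
  where
  open Circular A
  open Crossings A j
  unique : Unique Γ
  unique = Unique-map⁻ (proj₂ (proj₂ circuit))
  r≡ : ∀ {F V} → countᵇ isFwdAt Γ ≡ F → countᵇ isRevAt Γ ≡ V → + r Γ j ≡ p - + F + + V
  r≡ refl refl = r≡p-fwd+rev p circuit wind
  on-circle : fwd j ∈ Γ → + r Γ j ≡ p - + 1
  on-circle f∈ = trans (r≡ (countᵇ-unique isFwdAt⇒fwd j≟j unique f∈)
                           (countᵇ-absent isRevAt⇒rev (λ r∈ → no-fwd-and-rev (j , f∈ , r∈))))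
                       (+-identityʳ (p - + 1))
  on-cross : rev j ∈ Γ → + r Γ j ≡ p + + 1
  on-cross r∈ = trans (r≡ (countᵇ-absent isFwdAt⇒fwd (λ f∈ → no-fwd-and-rev (j , f∈ , r∈)))
                          (countᵇ-unique isRevAt⇒rev j≟j unique r∈))
                      (cong (_+ + 1) (+-identityʳ p))
  on-bullet : fwd j ∉ Γ → rev j ∉ Γ → + r Γ j ≡ p
  on-bullet f∉ r∉ = trans (r≡ (countᵇ-absent isFwdAt⇒fwd f∉) (countᵇ-absent isRevAt⇒rev r∉))
                          (trans (+-identityʳ (p - + 0)) (+-identityʳ p))
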